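{- For every integer $n\ge 3$, the automorphism group $\operatorname{Aut}(G_n)$ is isomorphic to the dihedral group $D_{5n}$ of order $10n$.
   Context: Let $P$ be the Petersen graph on vertex set $\{0,1,\dots,9\}$ whose 15 edges are the unordered pairs underlying the following set of directed edges (an orientation $\vec P$ of $P$): $E(\vec P)=\{(0,1),(0,4),(0,5),(1,2),(1,6),(2,3),(2,7),(3,4),(3,8),(4,9),(5,7),(5,8),(6,8),(6,9),(7,9)\}$. For $n\ge 3$ let $\sigma$ be the cyclic permutation of $\{1,\dots,n\}$ given by $\sigma(i)=i+1$ for $i<n$ and $\sigma(n)=1$. The graph $G_n$ is the simple undirected graph with vertex set $\{(i,x):1\le i\le n,\ 0\le x\le 9\}$ in which $(i,x)\sim(i,y)$ whenever $\{x,y\}$ is an edge of $P$, and $(i,x)\sim(\sigma(i),y)$ whenever $(x,y)\in E(\vec P)$. Here $D_{m}$ denotes the dihedral group of order $2m$. -}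

module Defs where

open import Data.Nat using (ℕ; zero; suc; _+_; _*_; _∸_; _≤_)
open import Data.Nat.DivMod using (_mod_)
open import Data.Fin using (Fin; toℕ)
open import Data.Bool using (Bool; true; false; not)
open import Data.Product using (_×_; _,_; Σ; ∃)
open import Data.Sum using (_⊎_)
open import Data.List using (List; []; _∷_)
open import Data.List.Membership.Propositional using (_∈_)
open import Relation.Binary.PropositionalEquality using (_≡_)
open import Function.Definitions using (Bijective)
open import Function.Bundles using (_⇔_)

petersenArcs : List (ℕ × ℕ)
petersenArcs =
  (0 , 1) ∷ (0 , 4) ∷ (0 , 5) ∷ (1 , 2) ∷ (1 , 6) ∷ (2 , 3) ∷ (2 , 7) ∷
  (3 , 4) ∷ (3 , 8) ∷ (4 , 9) ∷ (5 , 7) ∷ (5 , 8) ∷ (6 , 8) ∷ (6 , 9) ∷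
  (7 , 9) ∷ []

Arc : Fin 10 → Fin 10 → Set
Arc x y = (toℕ x , toℕ y) ∈ petersenArcs

PEdge : Fin 10 → Fin 10 → Set
PEdge x y = Arc x y ⊎ Arc y x

-- the cyclic permutation σ(i) = i + 1 (mod n) of the layer indices
-- (layers indexed by Fin n, i.e. 0..n-1 instead of 1..n)
σ : ∀ {n} → Fin n → Fin n
σ {suc m} i = (toℕ i + 1) mod (suc m)

V : ℕ → Set
V n = Fin n × Fin 10

Adj : ∀ {n} → V n → V n → Set
Adj (i , x) (j , y) =
  (i ≡ j × PEdge x y) ⊎ ((j ≡ σ i × Arc x y) ⊎ (i ≡ σ j × Arc y x))

record Aut (n : ℕ) : Set where
  field
    map        : V n → V n
    bijective  : Bijective _≡_ _≡_ map
    preserves  : ∀ u v → Adj u v ⇔ Adj (map u) (map v)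
open Aut public

-- The dihedral group D_m of order 2m: elements r^k s^e  (k ∈ Z/m, e ∈ {0,1}),
-- with s r = r⁻¹ s.
Dih : ℕ → Set
Dih m = Fin m × Bool

_·D_ : ∀ {m} → Dih m → Dih m → Dih m
_·D_ {suc m} (a , false) (b , e) = (toℕ a + toℕ b) mod (suc m) , e
_·D_ {suc m} (a , true)  (b , e) = (toℕ a + (suc m ∸ toℕ b)) mod (suc m) , not e

-- Group isomorphism Aut(G_n) ≅ D_m, where Aut(G_n) carries pointwise equality
-- of maps and composition (f ∘ g)(v) = f (g v).
record AutIsoDih (n m : ℕ) : Set where
  field
    φ           : Aut n → Dih m
    φ-cong      : ∀ f g → (∀ v → map f v ≡ map g v) → φ f ≡ φ g
    φ-injective : ∀ f g → φ f ≡ φ g → ∀ v → map f v ≡ map g v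
    φ-surjective : ∀ d → Σ (Aut n) (λ f → φ f ≡ d)
    φ-hom       : ∀ f g h → (∀ v → map h v ≡ map f (map g v)) →
                  φ h ≡ (φ f ·D φ g)

{-# OPTIONS --safe #-}
module Submission where

-- Two distinct vertices of G_n have three common neighbours exactly when they are (i , x) and
-- (i ± 1 , x); this is where n ≥ 3 is needed. Hence an automorphism h permutes the vertical
-- cycles {(i , x) | i} and has the form h (i , x) = (step_D^i (ℓ x) , π x). The ladders between
-- adjacent cycles show that the direction D is the same on every cycle and that ℓ y is ℓ x
-- shifted by an offset in {-1, 0, 1} fixed by D and the orientation of the edge π x π y; since
-- every vertex has exactly two neighbours of each adjacent colour, π is a local isomorphism of
-- the Petersen graph, so it is determined by the image of one 3-arc. Running through these
-- images by computation, only the ten colour permutations of the symmetries of the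
-- pentagon–pentagram drawing of P are consistent with the offsets, so h is determined by the
-- images of (0 , 0) and (0 , 1). A rotation r of order 5n and a reflection s realise every
-- possible pair of images, so d = (a , e) ↦ r^a s^e is an isomorphism D_{5n} ≅ Aut(G_n).

open import Defs
open import Data.Bool using (Bool; true; false; not; T; if_then_else_)
import Data.Bool.Properties as Bool
open import Data.Empty using (⊥; ⊥-elim)
open import Data.Fin using (Fin; toℕ; zero; suc)
open import Data.Fin.Patterns
open import Data.Fin.Properties using (all?; any?; toℕ-injective; toℕ-fromℕ<; toℕ<n)
  renaming (_≟_ to _≟ᶠ_)
open import Data.Integer as ℤ using (ℤ; +_; -[1+_]; 0ℤ; 1ℤ; -1ℤ; ∣_∣)
import Data.Integer.Properties as ℤ
open import Data.List using (allFin; find)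
open import Data.Maybe using (fromMaybe)
open import Data.Nat
  using (ℕ; zero; suc; _+_; _*_; _∸_; _≤_; _<_; _≤?_; _<?_; _%_; _/_; s≤s; z≤n)
open import Data.Nat.DivMod
  using (_mod_; m<n⇒m%n≡m; n%n≡0; m%n<n; m≡m%n+[m/n]*n; m<n*o⇒m/o<n)
open import Data.Nat.Properties
  using ( +-comm; *-comm; <-trans; <-irrefl; <⇒≤; n<1+n; ≤-refl; ≤-antisym; ≮⇒≥
        ; suc-injective; 0≢1+n; m∸n+n≡m)
  renaming (_≟_ to _≟ℕ_)
open import Data.Product using (_×_; _,_; ∃; ∃₂; proj₁; proj₂)
open import Data.Product.Properties using (≡-dec)
open import Data.List.Membership.DecPropositional (≡-dec _≟ℕ_ _≟ℕ_) using (_∈?_)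
open import Data.Sum as Sum using (_⊎_; inj₁; inj₂)
open import Function using (id; _∘_; Equivalence; mk⇔)
import Function.Endo.Propositional as Endo
open import Relation.Nullary using (Dec; yes; no; does; ¬?)
open import Relation.Nullary.Decidable
  using (True; False; toWitness; toWitnessFalse; from-yes; _×-dec_; _⊎-dec_; _→-dec_; T?; map′)
open import Relation.Binary.PropositionalEquality

_^_ : {A : Set} → (A → A) → ℕ → A → A
_^_ {A} = Endo._^_ A

^-+ : ∀ {A : Set} (f : A → A) m m′ x → (f ^ (m + m′)) x ≡ (f ^ m) ((f ^ m′) x)
^-+ {A} f m m′ x = cong-app (Endo.^-homo A f m m′) x

^-comm : ∀ {A : Set} (f : A → A) m m′ x → (f ^ m) ((f ^ m′) x) ≡ (f ^ m′) ((f ^ m) x)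
^-comm f m m′ x =
  trans (sym (^-+ f m m′ x)) (trans (cong (λ j → (f ^ j) x) (+-comm m m′)) (^-+ f m′ m x))

^-injective : ∀ {A : Set} (f : A → A) → (∀ {x y} → f x ≡ f y → x ≡ y) →
              ∀ m {x y} → (f ^ m) x ≡ (f ^ m) y → x ≡ y
^-injective f f-inj zero    e = e
^-injective f f-inj (suc m) e = ^-injective f f-inj m (f-inj e)

^-cancel : ∀ {A : Set} (g f : A → A) → (∀ x → g (f x) ≡ x) → ∀ m x → (g ^ m) ((f ^ m) x) ≡ x
^-cancel g f g∘f zero    x = refl
^-cancel g f g∘f (suc m) x =
  trans (sym (^-comm g m 1 _)) (trans (cong (g ^ m) (g∘f _)) (^-cancel g f g∘f m x))

pigeonhole : ∀ (a b c : Bool) → a ≡ b ⊎ a ≡ c ⊎ b ≡ c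
pigeonhole true  true  _     = inj₁ refl
pigeonhole false false _     = inj₁ refl
pigeonhole true  false true  = inj₂ (inj₁ refl)
pigeonhole true  false false = inj₂ (inj₂ refl)
pigeonhole false true  true  = inj₂ (inj₂ refl)
pigeonhole false true  false = inj₂ (inj₁ refl)

∀-Bool? : {P : Bool → Set} → (∀ b → Dec (P b)) → Dec (∀ b → P b)
∀-Bool? P? = map′ (λ (t , f) → λ { true → t ; false → f }) (λ p → p true , p false)
                  (P? true ×-dec P? false)

-- The oriented Petersen graph

arcᵇ : Fin 10 → Fin 10 → Bool
arcᵇ 0F 1F = true
arcᵇ 0F 4F = true
arcᵇ 0F 5F = true
arcᵇ 1F 2F = true
arcᵇ 1F 6F = true
arcᵇ 2F 3F = true
arcᵇ 2F 7F = true
arcᵇ 3F 4F = true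
arcᵇ 3F 8F = true
arcᵇ 4F 9F = true
arcᵇ 5F 7F = true
arcᵇ 5F 8F = true
arcᵇ 6F 8F = true
arcᵇ 6F 9F = true
arcᵇ 7F 9F = true
arcᵇ _  _  = false

Arc⇒arcᵇ : ∀ x y → Arc x y → T (arcᵇ x y)
Arc⇒arcᵇ = from-yes (all? λ x → all? λ y →
  ((toℕ x , toℕ y) ∈? petersenArcs) →-dec T? (arcᵇ x y))

arcᵇ⇒Arc : ∀ x y → T (arcᵇ x y) → Arc x y
arcᵇ⇒Arc = from-yes (all? λ x → all? λ y →
  T? (arcᵇ x y) →-dec ((toℕ x , toℕ y) ∈? petersenArcs))

Arc? : ∀ x y → Dec (Arc x y)
Arc? x y = map′ (arcᵇ⇒Arc x y) (Arc⇒arcᵇ x y) (T? (arcᵇ x y))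

PEdge? : ∀ x y → Dec (PEdge x y)
PEdge? x y = Arc? x y ⊎-dec Arc? y x

-- 0F when no vertex satisfies P.
some : {P : Fin 10 → Set} → (∀ x → Dec (P x)) → Fin 10
some P? = fromMaybe 0F (find P? (allFin 10))

common : Fin 10 → Fin 10 → Fin 10
common x z = some λ y → PEdge? x y ×-dec PEdge? y z

common-unique : ∀ x y z → x ≢ z → PEdge x y → PEdge y z → y ≡ common x z
common-unique = from-yes (all? λ x → all? λ y → all? λ z →
  ¬? (x ≟ᶠ z) →-dec PEdge? x y →-dec PEdge? y z →-dec y ≟ᶠ common x z)

third : Fin 10 → Fin 10 → Fin 10 → Fin 10
third x a b = some λ z → PEdge? x z ×-dec ¬? (z ≟ᶠ a) ×-dec ¬? (z ≟ᶠ b)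

third-unique : ∀ x a b z → PEdge x a → PEdge x b → a ≢ b → PEdge x z → z ≢ a → z ≢ b →
               z ≡ third x a b
third-unique = from-yes (all? λ x → all? λ a → all? λ b → all? λ z →
  PEdge? x a →-dec PEdge? x b →-dec ¬? (a ≟ᶠ b) →-dec
  PEdge? x z →-dec ¬? (z ≟ᶠ a) →-dec ¬? (z ≟ᶠ b) →-dec z ≟ᶠ third x a b)

neighbour : Fin 10 → Fin 3 → Fin 10
neighbour x = λ { 0F → y₀ ; 1F → y₁ ; 2F → third x y₀ y₁ }
  where
  y₀ = some (PEdge? x)
  y₁ = some λ y → PEdge? x y ×-dec ¬? (y ≟ᶠ y₀)

neighbour-adjacent : ∀ x j → PEdge x (neighbour x j)
neighbour-adjacent = from-yes (all? λ x → all? λ j → PEdge? x (neighbour x j))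

neighbour-injective : ∀ x j j′ → neighbour x j ≡ neighbour x j′ → j ≡ j′
neighbour-injective = from-yes (all? λ x → all? λ j → all? λ j′ →
  neighbour x j ≟ᶠ neighbour x j′ →-dec j ≟ᶠ j′)

module _ {A : Set} (f : Fin 10 → A) (along : ∀ x y → Arc x y → f x ≡ f y) where

  private
    a : ∀ x y → {True (Arc? x y)} → f x ≡ f y
    a x y {p} = along x y (toWitness p)

  connected : ∀ x → f x ≡ f 0F
  connected 0F = refl
  connected 1F = sym (a 0F 1F)
  connected 2F = sym (trans (a 0F 1F) (a 1F 2F))
  connected 3F = sym (trans (a 0F 4F) (sym (a 3F 4F)))
  connected 4F = sym (a 0F 4F)
  connected 5F = sym (a 0F 5F)
  connected 6F = sym (trans (a 0F 1F) (a 1F 6F))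
  connected 7F = sym (trans (a 0F 5F) (a 5F 7F))
  connected 8F = sym (trans (a 0F 5F) (a 5F 8F))
  connected 9F = sym (trans (a 0F 4F) (a 4F 9F))

-- Offsets, potentials and the standard colourings

dir : Bool → ℤ
dir true  = 1ℤ
dir false = -1ℤ

-- The y-coloured neighbours of (l , x) in G_n lie in the layers l + offset D x y, D ∈ Bool:
-- l and l + 1 if x → y is an arc, l - 1 and l if y → x is.
offset : Bool → Fin 10 → Fin 10 → ℤ
offset D x y = (if does (Arc? x y) then 0ℤ else -1ℤ) ℤ.+ (if D then 0ℤ else 1ℤ)

offset-forward : ∀ x y → Arc x y → offset true x y ≡ 0ℤ × offset false x y ≡ 1ℤ
offset-forward = from-yes (all? λ x → all? λ y → Arc? x y →-dec
  (offset true x y ℤ.≟ 0ℤ ×-dec offset false x y ℤ.≟ 1ℤ))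

offset-backward : ∀ x y → Arc y x → offset true x y ≡ -1ℤ × offset false x y ≡ 0ℤ
offset-backward = from-yes (all? λ x → all? λ y → Arc? y x →-dec
  (offset true x y ℤ.≟ -1ℤ ×-dec offset false x y ℤ.≟ 0ℤ))

offset-not : ∀ D x y → offset (not D) x y ≡ offset D x y ℤ.+ dir D
offset-not = from-yes (∀-Bool? λ D → all? λ x → all? λ y →
  offset (not D) x y ℤ.≟ offset D x y ℤ.+ dir D)

offset-round-trip : ∀ D₁ D₂ x y → PEdge x y →
  let z = offset D₂ y x ℤ.+ offset D₁ x y in z ≡ 0ℤ ⊎ z ≡ 1ℤ ⊎ z ≡ -1ℤ
offset-round-trip = from-yes (∀-Bool? λ D₁ → ∀-Bool? λ D₂ → all? λ x → all? λ y →
  PEdge? x y →-dec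
  (let z = offset D₂ y x ℤ.+ offset D₁ x y in z ℤ.≟ 0ℤ ⊎-dec z ℤ.≟ 1ℤ ⊎-dec z ℤ.≟ -1ℤ))

offset-step-small : ∀ d D₁ D₂ x y → ∣ (offset D₁ x y ℤ.+ dir d) ℤ.- offset D₂ x y ∣ ≤ 2
offset-step-small = from-yes (∀-Bool? λ d → ∀-Bool? λ D₁ → ∀-Bool? λ D₂ →
  all? λ x → all? λ y → ∣ (offset D₁ x y ℤ.+ dir d) ℤ.- offset D₂ x y ∣ ≤? 2)

offset-ladder : ∀ d e D₁ D₂ D₃ x y → offset D₁ x y ℤ.+ dir e ≡ offset D₂ x y →
                offset D₃ x y ℤ.+ dir d ≡ offset D₂ x y → d ≡ e × D₁ ≡ e
offset-ladder = from-yes (∀-Bool? λ d → ∀-Bool? λ e → ∀-Bool? λ D₁ → ∀-Bool? λ D₂ →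
  ∀-Bool? λ D₃ → all? λ x → all? λ y →
  offset D₁ x y ℤ.+ dir e ℤ.≟ offset D₂ x y →-dec
  offset D₃ x y ℤ.+ dir d ℤ.≟ offset D₂ x y →-dec
  (d Bool.≟ e ×-dec D₁ Bool.≟ e))

-- A spanning tree of P rooted at 0 whose edges are all arcs parent x → x.
parent : Fin 10 → Fin 10
parent 0F = 0F
parent 1F = 0F
parent 2F = 1F
parent 3F = 2F
parent 4F = 0F
parent 5F = 0F
parent 6F = 1F
parent 7F = 2F
parent 8F = 3F
parent 9F = 4F

depth : Fin 10 → ℕ
depth 0F = 0
depth 1F = 1
depth 2F = 2
depth 3F = 3
depth 4F = 1
depth 5F = 1
depth 6F = 2
depth 7F = 3
depth 8F = 4
depth 9F = 2

depth-zero : ∀ x → depth x ≡ 0 → x ≡ 0F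
depth-zero = from-yes (all? λ x → depth x ≟ℕ 0 →-dec x ≟ᶠ 0F)

tree-edge : ∀ x → x ≢ 0F → depth x ≡ suc (depth (parent x)) × Arc (parent x) x
tree-edge = from-yes (all? λ x → ¬? (x ≟ᶠ 0F) →-dec
  (depth x ≟ℕ suc (depth (parent x)) ×-dec Arc? (parent x) x))

tree-arc : ∀ x d → depth x ≡ suc d → depth (parent x) ≡ d × Arc (parent x) x
tree-arc x d depth-x =
  let (e , a) = tree-edge x (λ x≡0 → 0≢1+n (trans (cong depth (sym x≡0)) depth-x))
  in suc-injective (trans (sym e) depth-x) , a

potentialAt : Bool → (Fin 10 → Fin 10) → ℕ → Fin 10 → ℤ
potentialAt D π zero    x = 0ℤ
potentialAt D π (suc d) x = offset D (π (parent x)) (π x) ℤ.+ potentialAt D π d (parent x)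

potential : Bool → (Fin 10 → Fin 10) → Fin 10 → ℤ
potential D π x = potentialAt D π (depth x) x

potentialAt-cong : ∀ {D π π′} → (∀ x → π x ≡ π′ x) →
                   ∀ d x → potentialAt D π d x ≡ potentialAt D π′ d x
potentialAt-cong         π≗π′ zero    x = refl
potentialAt-cong {D} {π} π≗π′ (suc d) x = cong₂ ℤ._+_
  (cong₂ (offset D) (π≗π′ (parent x)) (π≗π′ x)) (potentialAt-cong π≗π′ d (parent x))

residual : Bool → (Fin 10 → Fin 10) → Fin 10 → Fin 10 → ℤ
residual D π x y = potential D π y ℤ.- (offset D (π x) (π y) ℤ.+ potential D π x)

-- Only residuals of absolute value at most 2 are visible: on a cycle of length n ≥ 3 a shift by
-- ±1 or ±2 fixes no layer, but longer shifts may.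
Consistent : Bool → (Fin 10 → Fin 10) → Set
Consistent D π = ∀ x y → Arc x y → ∣ residual D π x y ∣ ≤ 2 → residual D π x y ≡ 0ℤ

Consistent? : ∀ D π → Dec (Consistent D π)
Consistent? D π = all? λ x → all? λ y →
  Arc? x y →-dec ∣ residual D π x y ∣ ≤? 2 →-dec residual D π x y ℤ.≟ 0ℤ

Compatible : Bool → (Fin 10 → Fin 10) → (Fin 10 → ℤ) → Set
Compatible D π c = ∀ x y → Arc x y → PEdge (π x) (π y) × c y ≡ offset D (π x) (π y) ℤ.+ c x

Compatible? : ∀ D π c → Dec (Compatible D π c)
Compatible? D π c = all? λ x → all? λ y → Arc? x y →-dec
  (PEdge? (π x) (π y) ×-dec c y ℤ.≟ offset D (π x) (π y) ℤ.+ c x)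

-- The rotation and the reflection of the drawing of P as the pentagon 0 1 2 3 4 around the
-- pentagram 5 7 9 6 8, with the layer shifts that make them automorphisms of G_n.
rotate : Fin 10 → Fin 10
rotate 0F = 1F
rotate 1F = 2F
rotate 2F = 3F
rotate 3F = 4F
rotate 4F = 0F
rotate 5F = 6F
rotate 6F = 7F
rotate 7F = 8F
rotate 8F = 9F
rotate 9F = 5F

rotate⁻¹ : Fin 10 → Fin 10
rotate⁻¹ 0F = 4F
rotate⁻¹ 1F = 0F
rotate⁻¹ 2F = 1F
rotate⁻¹ 3F = 2F
rotate⁻¹ 4F = 3F
rotate⁻¹ 5F = 9F
rotate⁻¹ 6F = 5F
rotate⁻¹ 7F = 6F
rotate⁻¹ 8F = 7F
rotate⁻¹ 9F = 8F

reflect : Fin 10 → Fin 10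
reflect 0F = 0F
reflect 1F = 4F
reflect 2F = 3F
reflect 3F = 2F
reflect 4F = 1F
reflect 5F = 5F
reflect 6F = 9F
reflect 7F = 8F
reflect 8F = 7F
reflect 9F = 6F

rotate-shift : Fin 10 → ℤ
rotate-shift 4F = -1ℤ
rotate-shift 9F = -1ℤ
rotate-shift _  = 0ℤ

rotate⁻¹-shift : Fin 10 → ℤ
rotate⁻¹-shift 0F = 1ℤ
rotate⁻¹-shift 5F = 1ℤ
rotate⁻¹-shift _  = 0ℤ

reflect-shift : Fin 10 → ℤ
reflect-shift 0F = 0ℤ
reflect-shift 1F = 1ℤ
reflect-shift 2F = 1ℤ
reflect-shift 3F = 1ℤ
reflect-shift 4F = 1ℤ
reflect-shift 5F = 1ℤ
reflect-shift _  = + 2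

rotate-rotate⁻¹ : ∀ x → rotate (rotate⁻¹ x) ≡ x ×
                  rotate-shift (rotate⁻¹ x) ℤ.+ rotate⁻¹-shift x ≡ 0ℤ
rotate-rotate⁻¹ = from-yes (all? λ x →
  rotate (rotate⁻¹ x) ≟ᶠ x ×-dec rotate-shift (rotate⁻¹ x) ℤ.+ rotate⁻¹-shift x ℤ.≟ 0ℤ)

rotate⁻¹-rotate : ∀ x → rotate⁻¹ (rotate x) ≡ x ×
                  rotate⁻¹-shift (rotate x) ℤ.+ rotate-shift x ≡ 0ℤ
rotate⁻¹-rotate = from-yes (all? λ x →
  rotate⁻¹ (rotate x) ≟ᶠ x ×-dec rotate⁻¹-shift (rotate x) ℤ.+ rotate-shift x ℤ.≟ 0ℤ)

reflect-reflect : ∀ x → reflect (reflect x) ≡ x ×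
                  reflect-shift (reflect x) ℤ.- reflect-shift x ≡ 0ℤ
reflect-reflect = from-yes (all? λ x →
  reflect (reflect x) ≟ᶠ x ×-dec reflect-shift (reflect x) ℤ.- reflect-shift x ℤ.≟ 0ℤ)

reflect-rotate : ∀ x → reflect (rotate x) ≡ rotate⁻¹ (reflect x) ×
                 reflect-shift (rotate x) ℤ.- rotate-shift x ≡
                 rotate⁻¹-shift (reflect x) ℤ.+ reflect-shift x
reflect-rotate = from-yes (all? λ x → reflect (rotate x) ≟ᶠ rotate⁻¹ (reflect x) ×-dec
  reflect-shift (rotate x) ℤ.- rotate-shift x ℤ.≟ rotate⁻¹-shift (reflect x) ℤ.+ reflect-shift x)

rotate≢rotate⁻¹ : ∀ x → rotate x ≢ rotate⁻¹ x
rotate≢rotate⁻¹ = from-yes (all? λ x → ¬? (rotate x ≟ᶠ rotate⁻¹ x))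

standard : Fin 5 → Bool → Fin 10 → Fin 10
standard b D x = (rotate ^ toℕ b) (if D then x else reflect x)

IsStandard : Bool → (Fin 10 → Fin 10) → Set
IsStandard D π = ∃ λ b → ∀ x → π x ≡ standard b D x

IsStandard? : ∀ D π → Dec (IsStandard D π)
IsStandard? D π = any? λ b → all? λ x → π x ≟ᶠ standard b D x

standard-determined-by-edge : ∀ b D b′ D′ → standard b D 0F ≡ standard b′ D′ 0F →
                              standard b D 1F ≡ standard b′ D′ 1F → b ≡ b′ × D ≡ D′
standard-determined-by-edge = from-yes (all? λ b → ∀-Bool? λ D → all? λ b′ → ∀-Bool? λ D′ →
  standard b D 0F ≟ᶠ standard b′ D′ 0F →-dec standard b D 1F ≟ᶠ standard b′ D′ 1F →-dec
  (b ≟ᶠ b′ ×-dec D Bool.≟ D′))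

standard-edge-rotation : ∀ b → let x = standard b true 0F in
  toℕ x < 5 × standard b true 1F ≡ rotate x ×
  potential true (standard b true) 1F ≡ rotate-shift x
standard-edge-rotation = from-yes (all? λ b → let x = standard b true 0F in
  toℕ x <? 5 ×-dec standard b true 1F ≟ᶠ rotate x ×-dec
  potential true (standard b true) 1F ℤ.≟ rotate-shift x)

standard-edge-rotation⁻¹ : ∀ b → let x = standard b false 0F in
  toℕ x < 5 × standard b false 1F ≡ rotate⁻¹ x ×
  potential false (standard b false) 1F ≡ rotate⁻¹-shift x
standard-edge-rotation⁻¹ = from-yes (all? λ b → let x = standard b false 0F in
  toℕ x <? 5 ×-dec standard b false 1F ≟ᶠ rotate⁻¹ x ×-dec
  potential false (standard b false) 1F ℤ.≟ rotate⁻¹-shift x)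

-- The colouring sending the 3-arc 2 1 0 4 to p₂ p₁ p₀ p₄ and extended by adjacency.
extend3Arc : Fin 10 → Fin 10 → Fin 10 → Fin 10 → Fin 10 → Fin 10
extend3Arc p₀ p₁ p₂ p₄ 0F = p₀
extend3Arc p₀ p₁ p₂ p₄ 1F = p₁
extend3Arc p₀ p₁ p₂ p₄ 2F = p₂
extend3Arc p₀ p₁ p₂ p₄ 3F = common p₂ p₄
extend3Arc p₀ p₁ p₂ p₄ 4F = p₄
extend3Arc p₀ p₁ p₂ p₄ 5F = third p₀ p₁ p₄
extend3Arc p₀ p₁ p₂ p₄ 6F = third p₁ p₀ p₂
extend3Arc p₀ p₁ p₂ p₄ 7F = third p₂ p₁ (common p₂ p₄)
extend3Arc p₀ p₁ p₂ p₄ 8F = third (common p₂ p₄) p₂ p₄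
extend3Arc p₀ p₁ p₂ p₄ 9F = third p₄ p₀ (common p₂ p₄)

StandardOn3Arcs : Bool → Set
StandardOn3Arcs D = ∀ p₀ p₁ → PEdge p₀ p₁ → ∀ p₂ → PEdge p₁ p₂ → p₀ ≢ p₂ →
  ∀ p₄ → PEdge p₀ p₄ → p₁ ≢ p₄ →
  let π = extend3Arc p₀ p₁ p₂ p₄ in Consistent D π → IsStandard D π

standard-on-3-arcs? : ∀ D → Dec (StandardOn3Arcs D)
standard-on-3-arcs? D = all? λ p₀ → all? λ p₁ → PEdge? p₀ p₁ →-dec
  all? λ p₂ → PEdge? p₁ p₂ →-dec ¬? (p₀ ≟ᶠ p₂) →-dec
  all? λ p₄ → PEdge? p₀ p₄ →-dec ¬? (p₁ ≟ᶠ p₄) →-dec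
  let π = extend3Arc p₀ p₁ p₂ p₄ in Consistent? D π →-dec IsStandard? D π

standard-on-3-arcs : ∀ D → StandardOn3Arcs D
standard-on-3-arcs true  = from-yes (standard-on-3-arcs? true)
standard-on-3-arcs false = from-yes (standard-on-3-arcs? false)

record LocalIsomorphism (π : Fin 10 → Fin 10) : Set where
  field
    edge-preserving         : ∀ {x y} → PEdge x y → PEdge (π x) (π y)
    injective-on-neighbours : ∀ {x y z} → PEdge x y → PEdge x z → y ≢ z → π y ≢ π z

module _ {π : Fin 10 → Fin 10} (li : LocalIsomorphism π) where

  open LocalIsomorphism li

  private
    e : ∀ x y → {True (PEdge? x y)} → PEdge (π x) (π y)
    e x y {p} = edge-preserving (toWitness p)

    ni : ∀ x y z → {True (PEdge? x y)} → {True (PEdge? x z)} → {False (y ≟ᶠ z)} → π y ≢ π z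
    ni x y z {p} {q} {r} = injective-on-neighbours (toWitness p) (toWitness q) (toWitnessFalse r)

    π₃ : π 3F ≡ common (π 2F) (π 4F)
    π₃ = common-unique _ _ _ (ni 3F 2F 4F) (e 2F 3F) (e 3F 4F)

  local-isomorphism-determined-by-3-arc : ∀ x → π x ≡ extend3Arc (π 0F) (π 1F) (π 2F) (π 4F) x
  local-isomorphism-determined-by-3-arc 0F = refl
  local-isomorphism-determined-by-3-arc 1F = refl
  local-isomorphism-determined-by-3-arc 2F = refl
  local-isomorphism-determined-by-3-arc 3F = π₃
  local-isomorphism-determined-by-3-arc 4F = refl
  local-isomorphism-determined-by-3-arc 5F =
    third-unique _ _ _ _ (e 0F 1F) (e 0F 4F) (ni 0F 1F 4F) (e 0F 5F) (ni 0F 5F 1F) (ni 0F 5F 4F)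
  local-isomorphism-determined-by-3-arc 6F =
    third-unique _ _ _ _ (e 1F 0F) (e 1F 2F) (ni 1F 0F 2F) (e 1F 6F) (ni 1F 6F 0F) (ni 1F 6F 2F)
  local-isomorphism-determined-by-3-arc 7F = trans
    (third-unique _ _ _ _ (e 2F 1F) (e 2F 3F) (ni 2F 1F 3F) (e 2F 7F) (ni 2F 7F 1F) (ni 2F 7F 3F))
    (cong (third (π 2F) (π 1F)) π₃)
  local-isomorphism-determined-by-3-arc 8F = trans
    (third-unique _ _ _ _ (e 3F 2F) (e 3F 4F) (ni 3F 2F 4F) (e 3F 8F) (ni 3F 8F 2F) (ni 3F 8F 4F))
    (cong (λ c → third c (π 2F) (π 4F)) π₃)
  local-isomorphism-determined-by-3-arc 9F = trans
    (third-unique _ _ _ _ (e 4F 0F) (e 4F 3F) (ni 4F 0F 3F) (e 4F 9F) (ni 4F 9F 0F) (ni 4F 9F 3F))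
    (cong (third (π 4F) (π 0F)) π₃)

  consistent-local-isomorphisms-are-standard : ∀ D → Consistent D π → IsStandard D π
  consistent-local-isomorphisms-are-standard D consistent =
    let (b , π′-standard) = standard-on-3-arcs D _ _ (e 0F 1F) _ (e 1F 2F) (ni 1F 0F 2F)
                              _ (e 0F 4F) (ni 0F 1F 4F) consistent′
    in b , λ x → trans (π≗π′ x) (π′-standard x)
    where
    π′ = extend3Arc (π 0F) (π 1F) (π 2F) (π 4F)
    π≗π′ = local-isomorphism-determined-by-3-arc
    residual-cong : ∀ x y → residual D π x y ≡ residual D π′ x y
    residual-cong x y = cong₂ ℤ._-_ (potentialAt-cong π≗π′ (depth y) y)
      (cong₂ ℤ._+_ (cong₂ (offset D) (π≗π′ x) (π≗π′ y)) (potentialAt-cong π≗π′ (depth x) x))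
    consistent′ : Consistent D π′
    consistent′ x y a = subst (λ r → ∣ r ∣ ≤ 2 → r ≡ 0ℤ) (residual-cong x y) (consistent x y a)

module Cycle (k : ℕ) where

  n : ℕ
  n = suc (suc (suc k))

  L : Set
  L = Fin n

  toℕ-σ : ∀ i → suc (toℕ i) < n → toℕ (σ i) ≡ suc (toℕ i)
  toℕ-σ i lt = trans (toℕ-fromℕ< _) (trans (cong (_% n) (+-comm (toℕ i) 1)) (m<n⇒m%n≡m lt))

  σ-last : ∀ i → toℕ i ≡ suc (suc k) → σ i ≡ zero
  σ-last i last = toℕ-injective (begin
    toℕ (σ i)              ≡⟨ toℕ-fromℕ< _ ⟩
    (toℕ i + 1) % n        ≡⟨ cong (λ t → (t + 1) % n) last ⟩
    (suc (suc k) + 1) % n  ≡⟨ cong (_% n) (+-comm (suc (suc k)) 1) ⟩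
    n % n                  ≡⟨ n%n≡0 n ⟩
    0                      ∎)
    where open ≡-Reasoning

  toℕ-σ^ : ∀ m → m < n → toℕ ((σ ^ m) zero) ≡ m
  toℕ-σ^ zero    _  = refl
  toℕ-σ^ (suc m) lt = trans (toℕ-σ _ (subst (λ t → suc t < n) (sym ih) lt)) (cong suc ih)
    where ih = toℕ-σ^ m (<-trans (n<1+n m) lt)

  σ^toℕ : ∀ i → (σ ^ toℕ i) zero ≡ i
  σ^toℕ i = toℕ-injective (toℕ-σ^ (toℕ i) (toℕ<n i))

  σ^n : ∀ i → (σ ^ n) i ≡ i
  σ^n i = begin
    (σ ^ n) i                   ≡⟨ cong (σ ^ n) (σ^toℕ i) ⟨
    (σ ^ n) ((σ ^ toℕ i) zero)  ≡⟨ ^-comm σ n (toℕ i) zero ⟩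
    (σ ^ toℕ i) ((σ ^ n) zero)  ≡⟨ cong (σ ^ toℕ i) (σ-last _ (toℕ-σ^ (suc (suc k)) ≤-refl)) ⟩
    (σ ^ toℕ i) zero            ≡⟨ σ^toℕ i ⟩
    i                           ∎
    where open ≡-Reasoning

  ρ : L → L
  ρ = σ ^ suc (suc k)

  σ-ρ : ∀ i → σ (ρ i) ≡ i
  σ-ρ = σ^n

  ρ-σ : ∀ i → ρ (σ i) ≡ i
  ρ-σ i = trans (^-comm σ (suc (suc k)) 1 i) (σ^n i)

  ρ^n : ∀ i → (ρ ^ n) i ≡ i
  ρ^n i = trans (cong (ρ ^ n) (sym (σ^n i))) (^-cancel ρ σ ρ-σ n i)

  σ-injective : ∀ {i j} → σ i ≡ σ j → i ≡ j
  σ-injective {i} {j} e = trans (sym (ρ-σ i)) (trans (cong ρ e) (ρ-σ j))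

  σ^-moves : ∀ m i → 0 < m → m < n → (σ ^ m) i ≢ i
  σ^-moves m i 0<m m<n e = <-irrefl (sym (trans (sym (toℕ-σ^ m m<n)) (cong toℕ σ^m-zero))) 0<m
    where
    open ≡-Reasoning
    σ^m-zero : (σ ^ m) zero ≡ zero
    σ^m-zero = ^-injective σ σ-injective (toℕ i) (begin
      (σ ^ toℕ i) ((σ ^ m) zero)  ≡⟨ ^-comm σ (toℕ i) m zero ⟩
      (σ ^ m) ((σ ^ toℕ i) zero)  ≡⟨ cong (σ ^ m) (σ^toℕ i) ⟩
      (σ ^ m) i                   ≡⟨ e ⟩
      i                           ≡⟨ σ^toℕ i ⟨
      (σ ^ toℕ i) zero            ∎)

  σ-moves : ∀ i → σ i ≢ i
  σ-moves i = σ^-moves 1 i (s≤s z≤n) (s≤s (s≤s z≤n))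

  σ²-moves : ∀ i → σ (σ i) ≢ i
  σ²-moves i = σ^-moves 2 i (s≤s z≤n) (s≤s (s≤s (s≤s z≤n)))

  ρ^-reaches : ∀ i → (ρ ^ (n ∸ toℕ i)) zero ≡ i
  ρ^-reaches i = begin
    (ρ ^ (n ∸ t)) zero                    ≡⟨ cong (ρ ^ (n ∸ t)) (^-cancel ρ σ ρ-σ t zero) ⟨
    (ρ ^ (n ∸ t)) ((ρ ^ t) ((σ ^ t) zero)) ≡⟨ ^-+ ρ (n ∸ t) t _ ⟨
    (ρ ^ (n ∸ t + t)) ((σ ^ t) zero)
      ≡⟨ cong₂ (λ m j → (ρ ^ m) j) (m∸n+n≡m (<⇒≤ (toℕ<n i))) (σ^toℕ i) ⟩
    (ρ ^ n) i                             ≡⟨ ρ^n i ⟩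
    i                                     ∎
    where
    open ≡-Reasoning
    t = toℕ i

  ρ^-injective : ∀ m m′ → m < n → m′ < n → (ρ ^ m) zero ≡ (ρ ^ m′) zero → m ≡ m′
  ρ^-injective m m′ m<n m′<n e =
    trans (sym (toℕ-σ^ m m<n)) (trans (cong toℕ σ^m≡σ^m′) (toℕ-σ^ m′ m′<n))
    where
    open ≡-Reasoning
    σ^m≡σ^m′ : (σ ^ m) zero ≡ (σ ^ m′) zero
    σ^m≡σ^m′ = begin
      (σ ^ m) zero                         ≡⟨ cong (σ ^ m) (^-cancel σ ρ σ-ρ m′ zero) ⟨
      (σ ^ m) ((σ ^ m′) ((ρ ^ m′) zero))   ≡⟨ cong (λ j → (σ ^ m) ((σ ^ m′) j)) e ⟨
      (σ ^ m) ((σ ^ m′) ((ρ ^ m) zero))    ≡⟨ ^-comm σ m m′ _ ⟩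
      (σ ^ m′) ((σ ^ m) ((ρ ^ m) zero))    ≡⟨ cong (σ ^ m′) (^-cancel σ ρ σ-ρ m zero) ⟩
      (σ ^ m′) zero                        ∎

  shift : ℤ → L → L
  shift (+ m)    = σ ^ m
  shift -[1+ m ] = ρ ^ suc m

  shift-suc : ∀ z u → shift (1ℤ ℤ.+ z) u ≡ σ (shift z u)
  shift-suc (+ m)        u = refl
  shift-suc -[1+ zero ]  u = sym (σ-ρ u)
  shift-suc -[1+ suc m ] u = sym (σ-ρ _)

  shift-pred : ∀ z u → shift (-1ℤ ℤ.+ z) u ≡ ρ (shift z u)
  shift-pred (+ zero)  u = refl
  shift-pred (+ suc m) u = sym (ρ-σ _)
  shift-pred -[1+ m ]  u = refl

  shift-+ : ∀ a b u → shift (a ℤ.+ b) u ≡ shift a (shift b u)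
  shift-+ (+ zero)       b u = cong (λ z → shift z u) (ℤ.+-identityˡ b)
  shift-+ (+ suc m)      b u = begin
    shift (+ suc m ℤ.+ b) u            ≡⟨ cong (λ z → shift z u) (ℤ.+-assoc 1ℤ (+ m) b) ⟩
    shift (1ℤ ℤ.+ (+ m ℤ.+ b)) u       ≡⟨ shift-suc (+ m ℤ.+ b) u ⟩
    σ (shift (+ m ℤ.+ b) u)            ≡⟨ cong σ (shift-+ (+ m) b u) ⟩
    σ (shift (+ m) (shift b u))        ∎
    where open ≡-Reasoning
  shift-+ -[1+ zero ]    b u = shift-pred b u
  shift-+ -[1+ suc m ]   b u = begin
    shift (-[1+ suc m ] ℤ.+ b) u       ≡⟨ cong (λ z → shift z u) (ℤ.+-assoc -1ℤ -[1+ m ] b) ⟩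
    shift (-1ℤ ℤ.+ (-[1+ m ] ℤ.+ b)) u ≡⟨ shift-pred (-[1+ m ] ℤ.+ b) u ⟩
    ρ (shift (-[1+ m ] ℤ.+ b) u)       ≡⟨ cong ρ (shift-+ -[1+ m ] b u) ⟩
    ρ (shift -[1+ m ] (shift b u))     ∎
    where open ≡-Reasoning

  shift-cancel : ∀ a b u → a ℤ.+ b ≡ 0ℤ → shift a (shift b u) ≡ u
  shift-cancel a b u a+b≡0 = trans (sym (shift-+ a b u)) (cong (λ z → shift z u) a+b≡0)

  short-shift-fixes-nothing : ∀ z u → shift z u ≡ u → ∣ z ∣ ≤ 2 → z ≡ 0ℤ
  short-shift-fixes-nothing (+ zero)              u e _ = refl
  short-shift-fixes-nothing (+ 1)                 u e _ = ⊥-elim (σ-moves u e)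
  short-shift-fixes-nothing (+ 2)                 u e _ = ⊥-elim (σ²-moves u e)
  short-shift-fixes-nothing (+ suc (suc (suc _))) u e (s≤s (s≤s ()))
  short-shift-fixes-nothing -[1+ 0 ]              u e _ =
    ⊥-elim (σ-moves u (trans (cong σ (sym e)) (σ-ρ u)))
  short-shift-fixes-nothing -[1+ 1 ]              u e _ =
    ⊥-elim (σ²-moves u (trans (cong (σ ∘ σ) (sym e)) (trans (cong σ (σ-ρ (ρ u))) (σ-ρ u))))
  short-shift-fixes-nothing -[1+ suc (suc _) ]    u e (s≤s (s≤s ()))

  shift-difference : ∀ a b u → shift a u ≡ shift b u → shift (a ℤ.- b) u ≡ u
  shift-difference a b u e = begin
    shift (a ℤ.- b) u           ≡⟨ cong (λ z → shift z u) (ℤ.+-comm a (ℤ.- b)) ⟩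
    shift (ℤ.- b ℤ.+ a) u       ≡⟨ shift-+ (ℤ.- b) a u ⟩
    shift (ℤ.- b) (shift a u)   ≡⟨ cong (shift (ℤ.- b)) e ⟩
    shift (ℤ.- b) (shift b u)   ≡⟨ shift-cancel (ℤ.- b) b u (ℤ.+-inverseˡ b) ⟩
    u                           ∎
    where open ≡-Reasoning

  shift-injective-short : ∀ {a b} u → shift a u ≡ shift b u → ∣ a ℤ.- b ∣ ≤ 2 → a ≡ b
  shift-injective-short {a} {b} u e small =
    ℤ.i-j≡0⇒i≡j a b (short-shift-fixes-nothing (a ℤ.- b) u (shift-difference a b u e) small)

  step : Bool → L → L
  step D = shift (dir D)

  step-back : ∀ D u → step (not D) (step D u) ≡ u
  step-back true  = ρ-σ
  step-back false = σ-ρ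

  module Reversal {τ : L → L} (τ-σ : ∀ u → τ (σ u) ≡ ρ (τ u)) where

    τ-ρ : ∀ u → τ (ρ u) ≡ σ (τ u)
    τ-ρ u = trans (sym (σ-ρ (τ (ρ u)))) (cong σ (trans (sym (τ-σ (ρ u))) (cong τ (σ-ρ u))))

    τ-σ^ : ∀ m u → τ ((σ ^ m) u) ≡ (ρ ^ m) (τ u)
    τ-σ^ zero    u = refl
    τ-σ^ (suc m) u = trans (τ-σ _) (cong ρ (τ-σ^ m u))

    τ-ρ^ : ∀ m u → τ ((ρ ^ m) u) ≡ (σ ^ m) (τ u)
    τ-ρ^ zero    u = refl
    τ-ρ^ (suc m) u = trans (τ-ρ _) (cong σ (τ-ρ^ m u))

    τ-shift : ∀ z u → τ (shift z u) ≡ shift (ℤ.- z) (τ u)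
    τ-shift (+ zero)  u = refl
    τ-shift (+ suc m) u = τ-σ^ (suc m) u
    τ-shift -[1+ m ]  u = τ-ρ^ (suc m) u

  neg : L → L
  neg i = (ρ ^ toℕ i) zero

  neg-σ : ∀ i → neg (σ i) ≡ ρ (neg i)
  neg-σ i with suc (toℕ i) <? n
  ... | yes lt = cong (λ m → (ρ ^ m) zero) (toℕ-σ i lt)
  ... | no ¬lt =
    trans (cong neg (σ-last i last)) (sym (trans (cong (λ m → (ρ ^ suc m) zero) last) (ρ^n zero)))
    where
    last : toℕ i ≡ suc (suc k)
    last = suc-injective (≤-antisym (toℕ<n i) (≮⇒≥ ¬lt))

  open Reversal neg-σ public using () renaming (τ-shift to neg-shift)

  neg-neg : ∀ i → neg (neg i) ≡ i
  neg-neg i = trans (Reversal.τ-ρ^ neg-σ (toℕ i) zero) (σ^toℕ i)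

module Neighbourhoods (k : ℕ) where

  open Cycle k

  Adj-sym : ∀ {i j : L} {x y} → Adj (i , x) (j , y) → Adj (j , y) (i , x)
  Adj-sym (inj₁ (refl , inj₁ a)) = inj₁ (refl , inj₂ a)
  Adj-sym (inj₁ (refl , inj₂ a)) = inj₁ (refl , inj₁ a)
  Adj-sym (inj₂ (inj₁ e))        = inj₂ (inj₂ e)
  Adj-sym (inj₂ (inj₂ e))        = inj₂ (inj₁ e)

  Adj⇒PEdge : ∀ {l m : L} {X Y} → Adj (l , X) (m , Y) → PEdge X Y
  Adj⇒PEdge (inj₁ (_ , e))        = e
  Adj⇒PEdge (inj₂ (inj₁ (_ , a))) = inj₁ a
  Adj⇒PEdge (inj₂ (inj₂ (_ , a))) = inj₂ a

  neighbour-offset : ∀ {l m X Y} → Adj (l , X) (m , Y) → ∃ λ D → m ≡ shift (offset D X Y) l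
  neighbour-offset {l} {X = X} {Y} (inj₁ (refl , inj₁ a)) =
    true , cong (λ o → shift o l) (sym (proj₁ (offset-forward X Y a)))
  neighbour-offset {l} {X = X} {Y} (inj₁ (refl , inj₂ a)) =
    false , cong (λ o → shift o l) (sym (proj₂ (offset-backward X Y a)))
  neighbour-offset {l} {X = X} {Y} (inj₂ (inj₁ (refl , a))) =
    false , cong (λ o → shift o l) (sym (proj₂ (offset-forward X Y a)))
  neighbour-offset {l} {m} {X} {Y} (inj₂ (inj₂ (l≡σm , a))) =
    true , trans (trans (sym (ρ-σ m)) (cong ρ (sym l≡σm)))
                 (cong (λ o → shift o l) (sym (proj₁ (offset-backward X Y a))))

  neighbour-at-offset : ∀ {X Y} → PEdge X Y → ∀ D l → Adj (l , X) (shift (offset D X Y) l , Y)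
  neighbour-at-offset {X} {Y} (inj₁ a) true  l = subst (λ o → Adj (l , X) (shift o l , Y))
    (sym (proj₁ (offset-forward X Y a))) (inj₁ (refl , inj₁ a))
  neighbour-at-offset {X} {Y} (inj₁ a) false l = subst (λ o → Adj (l , X) (shift o l , Y))
    (sym (proj₂ (offset-forward X Y a))) (inj₂ (inj₁ (refl , a)))
  neighbour-at-offset {X} {Y} (inj₂ a) true  l = subst (λ o → Adj (l , X) (shift o l , Y))
    (sym (proj₁ (offset-backward X Y a))) (inj₂ (inj₂ (sym (σ-ρ l) , a)))
  neighbour-at-offset {X} {Y} (inj₂ a) false l = subst (λ o → Adj (l , X) (shift o l , Y))
    (sym (proj₂ (offset-backward X Y a))) (inj₁ (refl , inj₂ a))

  two-neighbours-of-colour : ∀ {X Y} → PEdge X Y → ∀ l →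
                             ∃₂ λ m m′ → m ≢ m′ × Adj (l , X) (m , Y) × Adj (l , X) (m′ , Y)
  two-neighbours-of-colour (inj₁ a) l =
    l , σ l , (λ e → σ-moves l (sym e)) , inj₁ (refl , inj₁ a) , inj₂ (inj₁ (refl , a))
  two-neighbours-of-colour (inj₂ a) l =
    l , ρ l , (λ e → σ-moves l (trans (cong σ e) (σ-ρ l))) ,
    inj₁ (refl , inj₂ a) , inj₂ (inj₂ (sym (σ-ρ l) , a))

  at-most-two-neighbours-of-colour : ∀ {l m₁ m₂ m₃ X Y} →
    Adj (l , X) (m₁ , Y) → Adj (l , X) (m₂ , Y) → Adj (l , X) (m₃ , Y) →
    m₁ ≡ m₂ ⊎ m₁ ≡ m₃ ⊎ m₂ ≡ m₃
  at-most-two-neighbours-of-colour {l} {X = X} {Y} a₁ a₂ a₃ =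
    let (D₁ , e₁) = neighbour-offset a₁
        (D₂ , e₂) = neighbour-offset a₂
        (D₃ , e₃) = neighbour-offset a₃
    in Sum.map (same e₁ e₂) (Sum.map (same e₁ e₃) (same e₂ e₃)) (pigeonhole D₁ D₂ D₃)
    where
    same : ∀ {m m′ D D′} → m ≡ shift (offset D X Y) l → m′ ≡ shift (offset D′ X Y) l →
           D ≡ D′ → m ≡ m′
    same e e′ refl = trans e (sym e′)

  no-three-neighbours-of-one-colour : ∀ {l X Y} (q : Fin 3 → V n) →
    (∀ j → Adj (l , X) (q j)) → (∀ j → proj₂ (q j) ≡ Y) →
    (∀ {j j′} → q j ≡ q j′ → j ≡ j′) → ⊥
  no-three-neighbours-of-one-colour {l} {X} {Y} q adjacent colour distinct =
    three-equal (at-most-two-neighbours-of-colour (a 0F) (a 1F) (a 2F))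
    where
    layer : Fin 3 → L
    layer j = proj₁ (q j)
    a : ∀ j → Adj (l , X) (layer j , Y)
    a j = subst (λ c → Adj (l , X) (layer j , c)) (colour j) (adjacent j)
    coincide : ∀ j j′ → layer j ≡ layer j′ → j ≡ j′
    coincide j j′ e = distinct
      (trans (cong (layer j ,_) (colour j)) (trans (cong (_, Y) e) (cong (layer j′ ,_) (sym (colour j′)))))
    0≢1 : _≢_ {A = Fin 3} 0F 1F
    0≢1 ()
    0≢2 : _≢_ {A = Fin 3} 0F 2F
    0≢2 ()
    1≢2 : _≢_ {A = Fin 3} 1F 2F
    1≢2 ()
    three-equal : layer 0F ≡ layer 1F ⊎ layer 0F ≡ layer 2F ⊎ layer 1F ≡ layer 2F → ⊥
    three-equal (inj₁ e)        = 0≢1 (coincide 0F 1F e)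
    three-equal (inj₂ (inj₁ e)) = 0≢2 (coincide 0F 2F e)
    three-equal (inj₂ (inj₂ e)) = 1≢2 (coincide 1F 2F e)

  record ThreeCommonNeighbours (u v : V n) : Set where
    field
      q        : Fin 3 → V n
      adjacent : ∀ j → Adj u (q j) × Adj (q j) v
      distinct : ∀ {j j′} → q j ≡ q j′ → j ≡ j′

  vertical-common-neighbours : ∀ i x → ThreeCommonNeighbours (i , x) (σ i , x)
  vertical-common-neighbours i x = record
    { q        = λ j → shift (offset false x (neighbour x j)) i , neighbour x j
    ; adjacent = λ j → neighbour-at-offset (neighbour-adjacent x j) false i , Adj-sym (from-above j)
    ; distinct = λ {j} {j′} e → neighbour-injective x j j′ (cong proj₂ e)
    }
    where
    from-above : ∀ j → Adj (σ i , x) (shift (offset false x (neighbour x j)) i , neighbour x j)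
    from-above j = subst (λ l → Adj (σ i , x) (l , y)) same-layer
                     (neighbour-at-offset (neighbour-adjacent x j) true (σ i))
      where
      y = neighbour x j
      same-layer : shift (offset true x y) (σ i) ≡ shift (offset false x y) i
      same-layer =
        trans (sym (shift-+ (offset true x y) 1ℤ i)) (cong (λ o → shift o i) (sym (offset-not true x y)))

  three-common-neighbours⇒same-colour : ∀ {l m X Z} → ThreeCommonNeighbours (l , X) (m , Z) → Z ≡ X
  three-common-neighbours⇒same-colour {X = X} {Z} shared with Z ≟ᶠ X
  ... | yes Z≡X = Z≡X
  ... | no  Z≢X = ⊥-elim (no-three-neighbours-of-one-colour q (proj₁ ∘ adjacent) colour distinct)
    where
    open ThreeCommonNeighbours shared
    colour : ∀ j → proj₂ (q j) ≡ common X Z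
    colour j = common-unique X (proj₂ (q j)) Z (λ e → Z≢X (sym e))
                 (Adj⇒PEdge (proj₁ (adjacent j))) (Adj⇒PEdge (proj₂ (adjacent j)))

  common-neighbour-of-same-colour : ∀ {l m m′ X Y} → Adj (l , X) (m′ , Y) → Adj (m′ , Y) (m , X) →
                                    m ≢ l → ∃ λ D → m ≡ step D l
  common-neighbour-of-same-colour {l} {m} {m′} {X} {Y} a₁ a₂ m≢l =
    round-trip-cases (offset-round-trip D₁ D₂ X Y (Adj⇒PEdge a₁))
    where
    D₁ = proj₁ (neighbour-offset a₁)
    D₂ = proj₁ (neighbour-offset a₂)
    z = offset D₂ Y X ℤ.+ offset D₁ X Y
    round-trip : m ≡ shift z l
    round-trip = trans (proj₂ (neighbour-offset a₂))
      (trans (cong (shift (offset D₂ Y X)) (proj₂ (neighbour-offset a₁)))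
             (sym (shift-+ (offset D₂ Y X) (offset D₁ X Y) l)))
    round-trip-cases : z ≡ 0ℤ ⊎ z ≡ 1ℤ ⊎ z ≡ -1ℤ → ∃ λ D → m ≡ step D l
    round-trip-cases (inj₁ z≡0)         = ⊥-elim (m≢l (trans round-trip (cong (λ z → shift z l) z≡0)))
    round-trip-cases (inj₂ (inj₁ z≡1))  = true  , trans round-trip (cong (λ z → shift z l) z≡1)
    round-trip-cases (inj₂ (inj₂ z≡-1)) = false , trans round-trip (cong (λ z → shift z l) z≡-1)

  three-common-neighbours⇒vertical : ∀ {l X b} → ThreeCommonNeighbours (l , X) b → b ≢ (l , X) →
                                     ∃ λ D → b ≡ (step D l , X)
  three-common-neighbours⇒vertical {l} {X} {m , Z} shared b≢ with Z ≟ᶠ X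
  ... | no  Z≢X  = ⊥-elim (Z≢X (three-common-neighbours⇒same-colour shared))
  ... | yes refl =
    let (D , m≡) = common-neighbour-of-same-colour (proj₁ (adjacent 0F)) (proj₂ (adjacent 0F))
                     (λ e → b≢ (cong (_, X) e))
    in D , cong (_, X) m≡
    where open ThreeCommonNeighbours shared

  ladder : ∀ {l m X Y} d e → Adj (l , X) (m , Y) → Adj (l , X) (step e m , Y) →
           Adj (step d l , X) (step e m , Y) → d ≡ e × m ≡ shift (offset e X Y) l
  ladder {l} {m} {X} {Y} d e a₁ a₂ a₃ =
    let (d≡e , D₁≡e) = offset-ladder d e D₁ D₂ D₃ X Y
                         (shift-injective-short l rung₁ (offset-step-small e D₁ D₂ X Y))
                         (shift-injective-short l rung₂ (offset-step-small d D₃ D₂ X Y))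
    in d≡e , subst (λ D → m ≡ shift (offset D X Y) l) D₁≡e m-layer
    where
    open ≡-Reasoning
    D₁ = proj₁ (neighbour-offset a₁)
    D₂ = proj₁ (neighbour-offset a₂)
    D₃ = proj₁ (neighbour-offset a₃)
    m-layer : m ≡ shift (offset D₁ X Y) l
    m-layer = proj₂ (neighbour-offset a₁)
    rung₁ : shift (offset D₁ X Y ℤ.+ dir e) l ≡ shift (offset D₂ X Y) l
    rung₁ = begin
      shift (offset D₁ X Y ℤ.+ dir e) l   ≡⟨ cong (λ z → shift z l) (ℤ.+-comm (offset D₁ X Y) (dir e)) ⟩
      shift (dir e ℤ.+ offset D₁ X Y) l   ≡⟨ shift-+ (dir e) (offset D₁ X Y) l ⟩
      step e (shift (offset D₁ X Y) l)    ≡⟨ cong (step e) m-layer ⟨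
      step e m                            ≡⟨ proj₂ (neighbour-offset a₂) ⟩
      shift (offset D₂ X Y) l             ∎
    rung₂ : shift (offset D₃ X Y ℤ.+ dir d) l ≡ shift (offset D₂ X Y) l
    rung₂ = begin
      shift (offset D₃ X Y ℤ.+ dir d) l   ≡⟨ shift-+ (offset D₃ X Y) (dir d) l ⟩
      shift (offset D₃ X Y) (step d l)    ≡⟨ proj₂ (neighbour-offset a₃) ⟨
      step e m                            ≡⟨ proj₂ (neighbour-offset a₂) ⟩
      shift (offset D₂ X Y) l             ∎

module Classification (k : ℕ) where

  open Cycle k
  open Neighbourhoods k

  standardMap : Fin 5 → Bool → L → V n → V n
  standardMap b D t (i , x) = (step D ^ toℕ i) (shift (potential D (standard b D) x) t) , standard b D x

  module _ (h : Aut n) where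

    private
      f : V n → V n
      f = map h

      f-injective : ∀ {u v} → f u ≡ f v → u ≡ v
      f-injective = proj₁ (bijective h)

      f-adjacent : ∀ {u v} → Adj u v → Adj (f u) (f v)
      f-adjacent {u} {v} = Equivalence.to (preserves h u v)

      vertical : ∀ i x → ∃ λ D → f (σ i , x) ≡ (step D (proj₁ (f (i , x))) , proj₂ (f (i , x)))
      vertical i x = three-common-neighbours⇒vertical image (λ e → σ-moves i (cong proj₁ (f-injective e)))
        where
        open ThreeCommonNeighbours (vertical-common-neighbours i x)
        image : ThreeCommonNeighbours (f (i , x)) (f (σ i , x))
        image = record
          { q        = f ∘ q
          ; adjacent = λ j → f-adjacent (proj₁ (adjacent j)) , f-adjacent (proj₂ (adjacent j))
          ; distinct = distinct ∘ f-injective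
          }

      π : Fin 10 → Fin 10
      π x = proj₂ (f (zero , x))

      ℓ : Fin 10 → L
      ℓ x = proj₁ (f (zero , x))

      δ : Fin 10 → Bool
      δ x = proj₁ (vertical zero x)

      along-fibre : ∀ m x → let v = f ((σ ^ m) zero , x) in
                    f (σ ((σ ^ m) zero) , x) ≡ (step (δ x) (proj₁ v) , proj₂ v)
      along-fibre zero    x = proj₂ (vertical zero x)
      along-fibre (suc m) x with vertical (σ ((σ ^ m) zero)) x
      ... | D , e with D Bool.≟ δ x
      ...   | yes refl = e
      ...   | no  D≢δ  = ⊥-elim (σ²-moves j (cong proj₁ (f-injective reversal)))
        where
        j = (σ ^ m) zero
        reversal : f (σ (σ j) , x) ≡ f (j , x)
        reversal = begin
          f (σ (σ j) , x)
            ≡⟨ e ⟩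
          step D (proj₁ (f (σ j , x))) , proj₂ (f (σ j , x))
            ≡⟨ cong (λ v → step D (proj₁ v) , proj₂ v) (along-fibre m x) ⟩
          step D (step (δ x) (proj₁ (f (j , x)))) , proj₂ (f (j , x))
            ≡⟨ cong (λ D′ → step D′ (step (δ x) (proj₁ (f (j , x)))) , proj₂ (f (j , x)))
                    (Bool.¬-not D≢δ) ⟩
          step (not (δ x)) (step (δ x) (proj₁ (f (j , x)))) , proj₂ (f (j , x))
            ≡⟨ cong (_, proj₂ (f (j , x))) (step-back (δ x) _) ⟩
          f (j , x)
            ∎
          where open ≡-Reasoning

      fibre : ∀ m x → f ((σ ^ m) zero , x) ≡ ((step (δ x) ^ m) (ℓ x) , π x)
      fibre zero    x = refl
      fibre (suc m) x = trans (along-fibre m x) (cong (λ v → step (δ x) (proj₁ v) , proj₂ v) (fibre m x))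

      f-fibre : ∀ i x → f (i , x) ≡ ((step (δ x) ^ toℕ i) (ℓ x) , π x)
      f-fibre i x =
        subst (λ j → f (j , x) ≡ ((step (δ x) ^ toℕ i) (ℓ x) , π x)) (σ^toℕ i) (fibre (toℕ i) x)

      colour : ∀ i x → proj₂ (f (i , x)) ≡ π x
      colour i x = cong proj₂ (f-fibre i x)

      arc-twist : ∀ a b → Arc a b → δ a ≡ δ b × ℓ b ≡ shift (offset (δ b) (π a) (π b)) (ℓ a)
      arc-twist a b arc = ladder (δ a) (δ b) same-layer cross-layer next-layer
        where
        same-layer : Adj (ℓ a , π a) (ℓ b , π b)
        same-layer = f-adjacent (inj₁ (refl , inj₁ arc))
        cross-layer : Adj (ℓ a , π a) (step (δ b) (ℓ b) , π b)
        cross-layer = subst (Adj (ℓ a , π a)) (fibre 1 b) (f-adjacent (inj₂ (inj₁ (refl , arc))))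
        next-layer : Adj (step (δ a) (ℓ a) , π a) (step (δ b) (ℓ b) , π b)
        next-layer = subst₂ Adj (fibre 1 a) (fibre 1 b) (f-adjacent (inj₁ (refl , inj₁ arc)))

      D : Bool
      D = δ 0F

      δ-constant : ∀ x → δ x ≡ D
      δ-constant = connected δ (λ a b arc → proj₁ (arc-twist a b arc))

      ℓ-arc : ∀ a b → Arc a b → ℓ b ≡ shift (offset D (π a) (π b)) (ℓ a)
      ℓ-arc a b arc = subst (λ D′ → ℓ b ≡ shift (offset D′ (π a) (π b)) (ℓ a))
                        (δ-constant b) (proj₂ (arc-twist a b arc))

      ℓ-potential : ∀ d x → depth x ≡ d → ℓ x ≡ shift (potentialAt D π d x) (ℓ 0F)
      ℓ-potential zero    x depth-x = cong ℓ (depth-zero x depth-x)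
      ℓ-potential (suc d) x depth-x = begin
        ℓ x                           ≡⟨ ℓ-arc p x (proj₂ (tree-arc x d depth-x)) ⟩
        shift o (ℓ p)                 ≡⟨ cong (shift o) (ℓ-potential d p (proj₁ (tree-arc x d depth-x))) ⟩
        shift o (shift rest (ℓ 0F))   ≡⟨ shift-+ o rest (ℓ 0F) ⟨
        shift (o ℤ.+ rest) (ℓ 0F)     ∎
        where
        open ≡-Reasoning
        p = parent x
        o = offset D (π p) (π x)
        rest = potentialAt D π d p

      consistent : Consistent D π
      consistent x y arc = short-shift-fixes-nothing _ (ℓ 0F)
        (shift-difference (potential D π y) (o ℤ.+ potential D π x) (ℓ 0F) (begin
          shift (potential D π y) (ℓ 0F)             ≡⟨ ℓ-potential _ y refl ⟨
          ℓ y                                        ≡⟨ ℓ-arc x y arc ⟩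
          shift o (ℓ x)                              ≡⟨ cong (shift o) (ℓ-potential _ x refl) ⟩
          shift o (shift (potential D π x) (ℓ 0F))   ≡⟨ shift-+ o (potential D π x) (ℓ 0F) ⟨
          shift (o ℤ.+ potential D π x) (ℓ 0F)       ∎))
        where
        open ≡-Reasoning
        o = offset D (π x) (π y)

      π-local-isomorphism : LocalIsomorphism π
      π-local-isomorphism = record
        { edge-preserving         = λ e → Adj⇒PEdge (f-adjacent (inj₁ (refl , e)))
        ; injective-on-neighbours = λ {x} {y} {z} → separated x y z
        }
        where
        separated : ∀ x y z → PEdge x y → PEdge x z → y ≢ z → π y ≢ π z
        separated x y z xy xz y≢z πy≡πz =
          let (m , m′ , m≢m′ , a , a′) = two-neighbours-of-colour xy zero
              c₁ = colour m y
              c₂ = colour m′ y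
              c₃ = trans (colour zero z) (sym πy≡πz)
          in Sum.[ (λ e → m≢m′ (cong proj₁ (coincide {m , y} {m′ , y} c₁ c₂ e)))
                 , Sum.[ (λ e → y≢z (cong proj₂ (coincide {m , y} {zero , z} c₁ c₃ e)))
                       , (λ e → y≢z (cong proj₂ (coincide {m′ , y} {zero , z} c₂ c₃ e))) ]′ ]′
             (at-most-two-neighbours-of-colour (image a c₁) (image a′ c₂) (image (inj₁ (refl , xz)) c₃))
          where
          coincide : ∀ {w w′} → proj₂ (f w) ≡ π y → proj₂ (f w′) ≡ π y →
                     proj₁ (f w) ≡ proj₁ (f w′) → w ≡ w′
          coincide {w} {w′} c c′ e = f-injective
            (trans (cong (proj₁ (f w) ,_) c) (trans (cong (_, π y) e) (cong (proj₁ (f w′) ,_) (sym c′))))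
          image : ∀ {w} → Adj (zero , x) w → proj₂ (f w) ≡ π y → Adj (ℓ x , π x) (proj₁ (f w) , π y)
          image {w} adj c = subst (λ c′ → Adj (ℓ x , π x) (proj₁ (f w) , c′)) c (f-adjacent adj)

      standardness : IsStandard D π
      standardness = consistent-local-isomorphisms-are-standard π-local-isomorphism D consistent

    automorphism-is-standardMap : ∃₂ λ b D → ∃ λ t → ∀ v → map h v ≡ standardMap b D t v
    automorphism-is-standardMap =
      b , D , ℓ 0F , λ (i , x) → trans (f-fibre i x) (cong₂ _,_ (layer i x) (π-standard x))
      where
      b = proj₁ standardness
      π-standard = proj₂ standardness
      layer : ∀ i x → (step (δ x) ^ toℕ i) (ℓ x) ≡
                      (step D ^ toℕ i) (shift (potential D (standard b D) x) (ℓ 0F))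
      layer i x = cong₂ (λ D′ t → (step D′ ^ toℕ i) t) (δ-constant x)
        (trans (ℓ-potential _ x refl) (cong (λ p → shift p (ℓ 0F)) (potentialAt-cong π-standard (depth x) x)))

module Symmetries (k : ℕ) where

  open Cycle k
  open Neighbourhoods k

  record Twisting : Set where
    field
      D          : Bool
      τ          : L → L
      τ-σ        : ∀ i → τ (σ i) ≡ step D (τ i)
      π          : Fin 10 → Fin 10
      c          : Fin 10 → ℤ
      compatible : Compatible D π c

  twist : Twisting → V n → V n
  twist t (i , x) = shift (c x) (τ i) , π x
    where open Twisting t

  module _ (t : Twisting) where

    open Twisting t

    private
      along-arc : ∀ i {x y} → Arc x y →
                  Adj (twist t (i , x)) (twist t (i , y)) × Adj (twist t (i , x)) (twist t (σ i , y))
      along-arc i {x} {y} a = same-layer , next-layer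
        where
        open ≡-Reasoning
        w = shift (c x) (τ i)
        o = offset D (π x) (π y)
        edge = proj₁ (compatible x y a)
        c-eq = proj₂ (compatible x y a)
        same-layer : Adj (w , π x) (shift (c y) (τ i) , π y)
        same-layer = subst (λ l → Adj (w , π x) (l , π y)) layer (neighbour-at-offset edge D w)
          where
          layer : shift o w ≡ shift (c y) (τ i)
          layer = trans (sym (shift-+ o (c x) (τ i))) (cong (λ z → shift z (τ i)) (sym c-eq))
        next-layer : Adj (w , π x) (shift (c y) (τ (σ i)) , π y)
        next-layer = subst (λ l → Adj (w , π x) (l , π y)) layer (neighbour-at-offset edge (not D) w)
          where
          swap : ∀ a b c → (a ℤ.+ b) ℤ.+ c ≡ (a ℤ.+ c) ℤ.+ b
          swap a b c =
            trans (ℤ.+-assoc a b c) (trans (cong (λ z → a ℤ.+ z) (ℤ.+-comm b c)) (sym (ℤ.+-assoc a c b)))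
          layer : shift (offset (not D) (π x) (π y)) w ≡ shift (c y) (τ (σ i))
          layer = begin
            shift (offset (not D) (π x) (π y)) w   ≡⟨ cong (λ z → shift z w) (offset-not D (π x) (π y)) ⟩
            shift (o ℤ.+ dir D) w                  ≡⟨ shift-+ (o ℤ.+ dir D) (c x) (τ i) ⟨
            shift ((o ℤ.+ dir D) ℤ.+ c x) (τ i)    ≡⟨ cong (λ z → shift z (τ i)) (swap o (dir D) (c x)) ⟩
            shift ((o ℤ.+ c x) ℤ.+ dir D) (τ i)    ≡⟨ cong (λ z → shift (z ℤ.+ dir D) (τ i)) c-eq ⟨
            shift (c y ℤ.+ dir D) (τ i)            ≡⟨ shift-+ (c y) (dir D) (τ i) ⟩
            shift (c y) (step D (τ i))             ≡⟨ cong (shift (c y)) (τ-σ i) ⟨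
            shift (c y) (τ (σ i))                  ∎

    twist-adjacent : ∀ {u v} → Adj u v → Adj (twist t u) (twist t v)
    twist-adjacent {i , x}         (inj₁ (refl , inj₁ a))   = proj₁ (along-arc i a)
    twist-adjacent {i , x}         (inj₁ (refl , inj₂ a))   = Adj-sym (proj₁ (along-arc i a))
    twist-adjacent {i , x}         (inj₂ (inj₁ (refl , a))) = proj₂ (along-arc i a)
    twist-adjacent {_ , x} {j , y} (inj₂ (inj₂ (refl , a))) = Adj-sym (proj₂ (along-arc j a))

  rotation : Twisting
  rotation = record
    { D = true ; τ = id ; τ-σ = λ _ → refl ; π = rotate ; c = rotate-shift
    ; compatible = from-yes (Compatible? true rotate rotate-shift)
    }

  rotation⁻¹ : Twisting
  rotation⁻¹ = record
    { D = true ; τ = id ; τ-σ = λ _ → refl ; π = rotate⁻¹ ; c = rotate⁻¹-shift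
    ; compatible = from-yes (Compatible? true rotate⁻¹ rotate⁻¹-shift)
    }

  reflection : Twisting
  reflection = record
    { D = false ; τ = neg ; τ-σ = neg-σ ; π = reflect ; c = reflect-shift
    ; compatible = from-yes (Compatible? false reflect reflect-shift)
    }

  r r⁻¹ s : V n → V n
  r   = twist rotation
  r⁻¹ = twist rotation⁻¹
  s   = twist reflection

  r-r⁻¹ : ∀ v → r (r⁻¹ v) ≡ v
  r-r⁻¹ (i , x) = let (rotated , shifted) = rotate-rotate⁻¹ x in
    cong₂ _,_ (shift-cancel (rotate-shift (rotate⁻¹ x)) (rotate⁻¹-shift x) i shifted) rotated

  r⁻¹-r : ∀ v → r⁻¹ (r v) ≡ v
  r⁻¹-r (i , x) = let (rotated , shifted) = rotate⁻¹-rotate x in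
    cong₂ _,_ (shift-cancel (rotate⁻¹-shift (rotate x)) (rotate-shift x) i shifted) rotated

  s-s : ∀ v → s (s v) ≡ v
  s-s (i , x) = let (reflected , shifted) = reflect-reflect x in cong₂ _,_ (begin
    shift (reflect-shift (reflect x)) (neg (shift (reflect-shift x) (neg i)))
      ≡⟨ cong (shift (reflect-shift (reflect x))) (neg-shift (reflect-shift x) (neg i)) ⟩
    shift (reflect-shift (reflect x)) (shift (ℤ.- reflect-shift x) (neg (neg i)))
      ≡⟨ shift-cancel (reflect-shift (reflect x)) (ℤ.- reflect-shift x) (neg (neg i)) shifted ⟩
    neg (neg i)
      ≡⟨ neg-neg i ⟩
    i ∎) reflected
    where open ≡-Reasoning

  s-r : ∀ v → s (r v) ≡ r⁻¹ (s v)
  s-r (i , x) = cong₂ _,_ layer (proj₁ (reflect-rotate x))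
    where
    open ≡-Reasoning
    layer : shift (reflect-shift (rotate x)) (neg (shift (rotate-shift x) i)) ≡
            shift (rotate⁻¹-shift (reflect x)) (shift (reflect-shift x) (neg i))
    layer = begin
      shift (reflect-shift (rotate x)) (neg (shift (rotate-shift x) i))
        ≡⟨ cong (shift (reflect-shift (rotate x))) (neg-shift (rotate-shift x) i) ⟩
      shift (reflect-shift (rotate x)) (shift (ℤ.- rotate-shift x) (neg i))
        ≡⟨ shift-+ (reflect-shift (rotate x)) (ℤ.- rotate-shift x) (neg i) ⟨
      shift (reflect-shift (rotate x) ℤ.- rotate-shift x) (neg i)
        ≡⟨ cong (λ z → shift z (neg i)) (proj₂ (reflect-rotate x)) ⟩
      shift (rotate⁻¹-shift (reflect x) ℤ.+ reflect-shift x) (neg i)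
        ≡⟨ shift-+ (rotate⁻¹-shift (reflect x)) (reflect-shift x) (neg i) ⟩
      shift (rotate⁻¹-shift (reflect x)) (shift (reflect-shift x) (neg i))
        ∎

  r⁵ : ∀ i x → (r ^ 5) (i , x) ≡ (ρ i , x)
  r⁵ i 0F = refl
  r⁵ i 1F = refl
  r⁵ i 2F = refl
  r⁵ i 3F = refl
  r⁵ i 4F = refl
  r⁵ i 5F = refl
  r⁵ i 6F = refl
  r⁵ i 7F = refl
  r⁵ i 8F = refl
  r⁵ i 9F = refl

module DihedralAction (k : ℕ) where

  open Cycle k
  open Neighbourhoods k
  open Classification k
  open Symmetries k

  N : ℕ
  N = 5 * n

  reflectIf : Bool → V n → V n
  reflectIf true  = s
  reflectIf false = id

  act : Dih N → V n → V n
  act (a , e) = (r ^ toℕ a) ∘ reflectIf e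

  act⁻¹ : Dih N → V n → V n
  act⁻¹ (a , e) = reflectIf e ∘ (r⁻¹ ^ toℕ a)

  act⁻¹-act : ∀ d v → act⁻¹ d (act d v) ≡ v
  act⁻¹-act (a , false) v = ^-cancel r⁻¹ r r⁻¹-r (toℕ a) v
  act⁻¹-act (a , true)  v = trans (cong s (^-cancel r⁻¹ r r⁻¹-r (toℕ a) (s v))) (s-s v)

  act-act⁻¹ : ∀ d v → act d (act⁻¹ d v) ≡ v
  act-act⁻¹ (a , false) v = ^-cancel r r⁻¹ r-r⁻¹ (toℕ a) v
  act-act⁻¹ (a , true)  v = trans (cong (r ^ toℕ a) (s-s _)) (^-cancel r r⁻¹ r-r⁻¹ (toℕ a) v)

  ^-adjacent : ∀ {g : V n → V n} → (∀ {u v} → Adj u v → Adj (g u) (g v)) →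
               ∀ m {u v} → Adj u v → Adj ((g ^ m) u) ((g ^ m) v)
  ^-adjacent g-adj zero    a = a
  ^-adjacent g-adj (suc m) a = g-adj (^-adjacent g-adj m a)

  act-adjacent : ∀ d {u v} → Adj u v → Adj (act d u) (act d v)
  act-adjacent (a , false) = ^-adjacent (twist-adjacent rotation) (toℕ a)
  act-adjacent (a , true)  = ^-adjacent (twist-adjacent rotation) (toℕ a) ∘ twist-adjacent reflection

  act⁻¹-adjacent : ∀ d {u v} → Adj u v → Adj (act⁻¹ d u) (act⁻¹ d v)
  act⁻¹-adjacent (a , false) = ^-adjacent (twist-adjacent rotation⁻¹) (toℕ a)
  act⁻¹-adjacent (a , true)  = twist-adjacent reflection ∘ ^-adjacent (twist-adjacent rotation⁻¹) (toℕ a)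

  automorphism : Dih N → Aut n
  automorphism d = record
    { map       = act d
    ; bijective = injective , λ v → act⁻¹ d v , λ u≡ → trans (cong (act d) u≡) (act-act⁻¹ d v)
    ; preserves = λ u v → mk⇔ (act-adjacent d)
                    (λ a → subst₂ Adj (act⁻¹-act d u) (act⁻¹-act d v) (act⁻¹-adjacent d a))
    }
    where
    injective : ∀ {u v} → act d u ≡ act d v → u ≡ v
    injective {u} {v} e = trans (sym (act⁻¹-act d u)) (trans (cong (act⁻¹ d) e) (act⁻¹-act d v))

  r^[m*5] : ∀ m i x → (r ^ (m * 5)) (i , x) ≡ ((ρ ^ m) i , x)
  r^[m*5] zero    i x = refl
  r^[m*5] (suc m) i x = trans (^-+ r 5 (m * 5) (i , x)) (trans (cong (r ^ 5) (r^[m*5] m i x)) (r⁵ _ x))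

  r^N : ∀ v → (r ^ N) v ≡ v
  r^N (i , x) = trans (cong (λ j → (r ^ j) (i , x)) (*-comm 5 n)) (trans (r^[m*5] n i x) (cong (_, x) (ρ^n i)))

  r^-mod : ∀ m v → (r ^ (m % N)) v ≡ (r ^ m) v
  r^-mod m v = sym (begin
    (r ^ m) v                               ≡⟨ cong (λ j → (r ^ j) v) (m≡m%n+[m/n]*n m N) ⟩
    (r ^ (m % N + (m / N) * N)) v           ≡⟨ ^-+ r (m % N) ((m / N) * N) v ⟩
    (r ^ (m % N)) ((r ^ ((m / N) * N)) v)   ≡⟨ cong (r ^ (m % N)) (r^multiple (m / N) v) ⟩
    (r ^ (m % N)) v                         ∎)
    where
    open ≡-Reasoning
    r^multiple : ∀ q v → (r ^ (q * N)) v ≡ v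
    r^multiple zero    v = refl
    r^multiple (suc q) v = trans (^-+ r N (q * N) v) (trans (cong (r ^ N) (r^multiple q v)) (r^N v))

  s-r^ : ∀ m v → s ((r ^ m) v) ≡ (r⁻¹ ^ m) (s v)
  s-r^ zero    v = refl
  s-r^ (suc m) v = trans (s-r _) (cong r⁻¹ (s-r^ m v))

  r⁻¹^≡r^ : ∀ m → m ≤ N → ∀ v → (r⁻¹ ^ m) v ≡ (r ^ (N ∸ m)) v
  r⁻¹^≡r^ m m≤N v = begin
    (r⁻¹ ^ m) v                             ≡⟨ r^N _ ⟨
    (r ^ N) ((r⁻¹ ^ m) v)                   ≡⟨ cong (λ j → (r ^ j) ((r⁻¹ ^ m) v)) (m∸n+n≡m m≤N) ⟨
    (r ^ (N ∸ m + m)) ((r⁻¹ ^ m) v)         ≡⟨ ^-+ r (N ∸ m) m _ ⟩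
    (r ^ (N ∸ m)) ((r ^ m) ((r⁻¹ ^ m) v))   ≡⟨ cong (r ^ (N ∸ m)) (^-cancel r r⁻¹ r-r⁻¹ m v) ⟩
    (r ^ (N ∸ m)) v                         ∎
    where open ≡-Reasoning

  s-reflectIf : ∀ e v → s (reflectIf e v) ≡ reflectIf (not e) v
  s-reflectIf true  = s-s
  s-reflectIf false v = refl

  act-· : ∀ d₁ d₂ v → act d₁ (act d₂ v) ≡ act (d₁ ·D d₂) v
  act-· (a , false) (b , e) v = begin
    (r ^ toℕ a) ((r ^ toℕ b) (reflectIf e v))     ≡⟨ ^-+ r (toℕ a) (toℕ b) _ ⟨
    (r ^ (toℕ a + toℕ b)) (reflectIf e v)         ≡⟨ r^-mod (toℕ a + toℕ b) _ ⟨
    (r ^ ((toℕ a + toℕ b) % N)) (reflectIf e v)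
      ≡⟨ cong (λ j → (r ^ j) (reflectIf e v)) (toℕ-fromℕ< (m%n<n (toℕ a + toℕ b) N)) ⟨
    act ((toℕ a + toℕ b) mod N , e) v             ∎
    where open ≡-Reasoning
  act-· (a , true)  (b , e) v = begin
    (r ^ toℕ a) (s ((r ^ toℕ b) (reflectIf e v)))
      ≡⟨ cong (r ^ toℕ a) (s-r^ (toℕ b) _) ⟩
    (r ^ toℕ a) ((r⁻¹ ^ toℕ b) (s (reflectIf e v)))
      ≡⟨ cong (r ^ toℕ a) (r⁻¹^≡r^ (toℕ b) (<⇒≤ (toℕ<n b)) _) ⟩
    (r ^ toℕ a) ((r ^ (N ∸ toℕ b)) (s (reflectIf e v)))
      ≡⟨ cong (λ w → (r ^ toℕ a) ((r ^ (N ∸ toℕ b)) w)) (s-reflectIf e v) ⟩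
    (r ^ toℕ a) ((r ^ (N ∸ toℕ b)) (reflectIf (not e) v))
      ≡⟨ ^-+ r (toℕ a) (N ∸ toℕ b) _ ⟨
    (r ^ (toℕ a + (N ∸ toℕ b))) (reflectIf (not e) v)
      ≡⟨ r^-mod (toℕ a + (N ∸ toℕ b)) _ ⟨
    (r ^ ((toℕ a + (N ∸ toℕ b)) % N)) (reflectIf (not e) v)
      ≡⟨ cong (λ j → (r ^ j) (reflectIf (not e) v)) (toℕ-fromℕ< (m%n<n (toℕ a + (N ∸ toℕ b)) N)) ⟨
    act ((toℕ a + (N ∸ toℕ b)) mod N , not e) v
      ∎
    where open ≡-Reasoning

  q₀ q₁ : V n
  q₀ = zero , 0F
  q₁ = zero , 1F

  turn : Bool → V n → V n
  turn true  = r
  turn false = r⁻¹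

  act-q₀ : ∀ a e → act (a , e) q₀ ≡ (r ^ toℕ a) q₀
  act-q₀ a true  = refl
  act-q₀ a false = refl

  act-q₁ : ∀ a e → act (a , e) q₁ ≡ turn (not e) ((r ^ toℕ a) q₀)
  act-q₁ a false = ^-comm r (toℕ a) 1 q₀
  act-q₁ a true  = r^-r⁻¹ (toℕ a) q₀
    where
    r^-r⁻¹ : ∀ m v → (r ^ m) (r⁻¹ v) ≡ r⁻¹ ((r ^ m) v)
    r^-r⁻¹ zero    v = refl
    r^-r⁻¹ (suc m) v = trans (cong r (r^-r⁻¹ m v)) (trans (r-r⁻¹ _) (sym (r⁻¹-r _)))

  r^-outer : ∀ b l → b < 5 → ∃ λ x → toℕ x ≡ b × (r ^ b) (l , 0F) ≡ (l , x)
  r^-outer 0 l _ = 0F , refl , refl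
  r^-outer 1 l _ = 1F , refl , refl
  r^-outer 2 l _ = 2F , refl , refl
  r^-outer 3 l _ = 3F , refl , refl
  r^-outer 4 l _ = 4F , refl , refl
  r^-outer (suc (suc (suc (suc (suc _))))) l (s≤s (s≤s (s≤s (s≤s (s≤s ())))))

  orbit : ∀ m b → b < 5 → ∃ λ x → toℕ x ≡ b × (r ^ (b + m * 5)) q₀ ≡ ((ρ ^ m) zero , x)
  orbit m b b<5 =
    let (x , toℕx , e) = r^-outer b ((ρ ^ m) zero) b<5
    in x , toℕx , trans (^-+ r b (m * 5) q₀) (trans (cong (r ^ b) (r^[m*5] m zero 0F)) e)

  orbit-injective : ∀ a a′ → a < N → a′ < N → (r ^ a) q₀ ≡ (r ^ a′) q₀ → a ≡ a′
  orbit-injective a a′ a<N a′<N e = begin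
    a                         ≡⟨ m≡m%n+[m/n]*n a 5 ⟩
    a % 5 + (a / 5) * 5       ≡⟨ cong₂ (λ b m → b + m * 5) same-remainder same-quotient ⟩
    a′ % 5 + (a′ / 5) * 5     ≡⟨ m≡m%n+[m/n]*n a′ 5 ⟨
    a′                        ∎
    where
    open ≡-Reasoning
    split : ∀ a → (r ^ a) q₀ ≡ (r ^ (a % 5 + (a / 5) * 5)) q₀
    split a = cong (λ j → (r ^ j) q₀) (m≡m%n+[m/n]*n a 5)
    o  = orbit (a / 5) (a % 5) (m%n<n a 5)
    o′ = orbit (a′ / 5) (a′ % 5) (m%n<n a′ 5)
    same-point : ((ρ ^ (a / 5)) zero , proj₁ o) ≡ ((ρ ^ (a′ / 5)) zero , proj₁ o′)
    same-point = trans (sym (proj₂ (proj₂ o)))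
                   (trans (sym (split a)) (trans e (trans (split a′) (proj₂ (proj₂ o′)))))
    same-remainder : a % 5 ≡ a′ % 5
    same-remainder =
      trans (sym (proj₁ (proj₂ o))) (trans (cong (toℕ ∘ proj₂) same-point) (proj₁ (proj₂ o′)))
    quotient< : ∀ {a} → a < N → a / 5 < n
    quotient< {a} a<N = m<n*o⇒m/o<n {a} {n} {5} (subst (a <_) (*-comm 5 n) a<N)
    same-quotient : a / 5 ≡ a′ / 5
    same-quotient = ρ^-injective _ _ (quotient< a<N) (quotient< a′<N) (cong proj₁ same-point)

  orbit-surjective : ∀ l x → toℕ x < 5 → ∃ λ (a : Fin N) → (r ^ toℕ a) q₀ ≡ (l , x)
  orbit-surjective l x x<5 = (b + m * 5) mod N , (begin
    (r ^ toℕ ((b + m * 5) mod N)) q₀   ≡⟨ cong (λ j → (r ^ j) q₀) (toℕ-fromℕ< (m%n<n (b + m * 5) N)) ⟩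
    (r ^ ((b + m * 5) % N)) q₀         ≡⟨ r^-mod (b + m * 5) q₀ ⟩
    (r ^ (b + m * 5)) q₀               ≡⟨ proj₂ (proj₂ o) ⟩
    ((ρ ^ m) zero , proj₁ o)           ≡⟨ cong₂ _,_ (ρ^-reaches l) (toℕ-injective (proj₁ (proj₂ o))) ⟩
    (l , x)                            ∎)
    where
    open ≡-Reasoning
    b = toℕ x
    m = n ∸ toℕ l
    o = orbit m b x<5

  act-injective : ∀ {d d′} → (∀ v → act d v ≡ act d′ v) → d ≡ d′
  act-injective {a , e} {a′ , e′} act≗ = cong₂ _,_ a≡a′ (same-turn e e′ turns)
    where
    a≡a′ : a ≡ a′
    a≡a′ = toℕ-injective (orbit-injective (toℕ a) (toℕ a′) (toℕ<n a) (toℕ<n a′)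
             (trans (sym (act-q₀ a e)) (trans (act≗ q₀) (act-q₀ a′ e′))))
    turns : turn (not e) ((r ^ toℕ a) q₀) ≡ turn (not e′) ((r ^ toℕ a) q₀)
    turns = trans (sym (act-q₁ a e)) (trans (act≗ q₁)
              (trans (act-q₁ a′ e′) (cong (λ a → turn (not e′) ((r ^ toℕ a) q₀)) (sym a≡a′))))
    same-turn : ∀ e e′ {w} → turn (not e) w ≡ turn (not e′) w → e ≡ e′
    same-turn false false _ = refl
    same-turn true  true  _ = refl
    same-turn false true  t = ⊥-elim (rotate≢rotate⁻¹ _ (cong proj₂ t))
    same-turn true  false t = ⊥-elim (rotate≢rotate⁻¹ _ (cong proj₂ (sym t)))

  standardMap-edge : ∀ b D t → toℕ (proj₂ (standardMap b D t q₀)) < 5 ×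
                               standardMap b D t q₁ ≡ turn D (standardMap b D t q₀)
  standardMap-edge b true  t = let (x<5 , rotated , shifted) = standard-edge-rotation b in
    x<5 , cong₂ _,_ (cong (λ z → shift z t) shifted) rotated
  standardMap-edge b false t = let (x<5 , rotated , shifted) = standard-edge-rotation⁻¹ b in
    x<5 , cong₂ _,_ (cong (λ z → shift z t) shifted) rotated

  standardMap-edge-realised : ∀ b D t →
    ∃ λ d → act d q₀ ≡ standardMap b D t q₀ × act d q₁ ≡ standardMap b D t q₁
  standardMap-edge-realised b D t =
    let (x<5 , q₁-turn) = standardMap-edge b D t
        (a , reach) = orbit-surjective t (standard b D 0F) x<5
    in (a , not D) , trans (act-q₀ a (not D)) reach ,
       trans (act-q₁ a (not D)) (trans (cong₂ turn (Bool.not-involutive D) reach) (sym q₁-turn))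

  standardMap-determined-by-edge : ∀ {b D t b′ D′ t′} →
    standardMap b D t q₀ ≡ standardMap b′ D′ t′ q₀ →
    standardMap b D t q₁ ≡ standardMap b′ D′ t′ q₁ →
    ∀ v → standardMap b D t v ≡ standardMap b′ D′ t′ v
  standardMap-determined-by-edge {b} {D} {t} {b′} {D′} {t′} on-q₀ on-q₁ v =
    let (b≡b′ , D≡D′) = standard-determined-by-edge b D b′ D′ (cong proj₂ on-q₀) (cong proj₂ on-q₁)
    in cong₂ (λ (b , D) t → standardMap b D t v) (cong₂ _,_ b≡b′ D≡D′) (cong proj₁ on-q₀)

  automorphism-is-act : (h : Aut n) → ∃ λ d → ∀ v → map h v ≡ act d v
  automorphism-is-act h =
    let (b , D , t , h≗) = automorphism-is-standardMap h
        (d , on-q₀ , on-q₁) = standardMap-edge-realised b D t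
        (b′ , D′ , t′ , d≗) = automorphism-is-standardMap (automorphism d)
        same = standardMap-determined-by-edge {b} {D} {t} {b′} {D′} {t′}
                 (trans (sym on-q₀) (d≗ q₀)) (trans (sym on-q₁) (d≗ q₁))
    in d , λ v → trans (h≗ v) (trans (same v) (sym (d≗ v)))

  iso : AutIsoDih n N
  iso = record
    { φ            = φ
    ; φ-cong       = λ f g f≗g → act-injective (λ v → trans (sym (acts f v)) (trans (f≗g v) (acts g v)))
    ; φ-injective  = λ f g φf≡φg v → trans (acts f v) (trans (cong (λ d → act d v) φf≡φg) (sym (acts g v)))
    ; φ-surjective = λ d → automorphism d , act-injective (λ v → sym (acts (automorphism d) v))
    ; φ-hom        = λ f g h h≗fg → act-injective (λ v → begin
        act (φ h) v               ≡⟨ acts h v ⟨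
        map h v                   ≡⟨ h≗fg v ⟩
        map f (map g v)           ≡⟨ cong (map f) (acts g v) ⟩
        map f (act (φ g) v)       ≡⟨ acts f _ ⟩
        act (φ f) (act (φ g) v)   ≡⟨ act-· (φ f) (φ g) v ⟩
        act (φ f ·D φ g) v        ∎)
    }
    where
    open ≡-Reasoning
    φ : Aut n → Dih N
    φ h = proj₁ (automorphism-is-act h)
    acts : ∀ h v → map h v ≡ act (φ h) v
    acts h = proj₂ (automorphism-is-act h)

theorem4p1 : (n : ℕ) → 3 ≤ n → AutIsoDih n (5 * n)
theorem4p1 0                   ()
theorem4p1 1                   (s≤s ())
theorem4p1 2                   (s≤s (s≤s ()))
theorem4p1 (suc (suc (suc k))) _ = DihedralAction.iso k
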